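{- Let \(\kappa\) be a cube-consistent diamond field on \(J(P)\). Then there exists a unique edge field \(g^{(0)}\) such that (1) \(g^{(0)}(K^-,m(K))=0\) for every nonempty ideal \(K\), and (2) the curvature field of \(g^{(0)}\) equals \(\kappa\).
   Context: Let \(P=(S,\preceq)\) be a finite poset, and fix a total order \(\tau\) on \(S\) extending \(\preceq\); write \(u<_\tau v\) if \(u\) precedes \(v\) in \(\tau\). \(J(P)\) is the set of downward-closed subsets (ideals) of \(S\). For \(I\in J(P)\), \(\mathcal A(I)=\{a\in S\setminus I:\ \{u:u\prec a\}\subseteq I\}\). An edge field is a function \(g:\{(I,a):I\in J(P),a\in\mathcal A(I)\}\to\mathbb R\). A diamond \((K;a,b)\) consists of \(K\in J(P)\) and incomparable \(a,b\in\mathcal A(K)\) with \(a<_\tau b\); the curvature field of \(g\) is \(\kappa_g(K;a,b)=g(K,b)+g(K\cup\{b\},a)-g(K,a)-g(K\cup\{a\},b)\). A diamond field is any real function on diamonds; it is cube-consistent if for every \(I\in J(P)\) and pairwise incomparable \(u<_\tau v<_\tau w\) in \(\mathcal A(I)\): \(\kappa(I;u,v)-\kappa(I\cup\{w\};u,v)-\kappa(I;u,w)+\kappa(I\cup\{v\};u,w)+\kappa(I;v,w)-\kappa(I\cup\{u\};v,w)=0\). For a nonempty ideal \(K\), \(m(K)\) is the \(<_\tau\)-maximum of \(K\) and \(K^-=K\setminus\{m(K)\}\). -}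

module Defs where

open import Level using (Level; _⊔_)
open import Data.Nat using (ℕ)
open import Data.Fin using (Fin)
open import Data.Fin.Subset using (Subset; _∈_; _∉_; _∪_; _─_; ⁅_⁆)
open import Data.Product using (_×_; Σ; ∃)
open import Relation.Binary.PropositionalEquality using (_≡_; _≢_)
open import Relation.Nullary using (¬_)
open import Algebra.Bundles using (AbelianGroup)

-- Ground set S = Fin n; the poset order _≼_ and the linear extension _<τ_
-- (a strict total order) are arbitrary relations on Fin n.
-- The coefficient ring ℝ is replaced by an arbitrary abelian group G
-- (only the additive group structure of ℝ is used).
module Setup {n : ℕ} {p t c ℓ : Level}
             (_≼_ : Fin n → Fin n → Set p)
             (_<τ_ : Fin n → Fin n → Set t)
             (G : AbelianGroup c ℓ) where

  open AbelianGroup G renaming (Carrier to A)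

  _⊖_ : A → A → A
  x ⊖ y = x ∙ (y ⁻¹)

  _≺_ : Fin n → Fin n → Set p
  u ≺ a = (u ≼ a) × (u ≢ a)

  Incomparable : Fin n → Fin n → Set p
  Incomparable a b = (¬ (a ≼ b)) × (¬ (b ≼ a))

  -- ideals (downward-closed subsets), i.e. elements of J(P)
  IsIdeal : Subset n → Set p
  IsIdeal I = ∀ a b → b ≼ a → a ∈ I → b ∈ I

  InA : Subset n → Fin n → Set p
  InA I a = (a ∉ I) × (∀ u → u ≺ a → u ∈ I)

  -- An edge field is represented by a total function Subset n → Fin n → A;
  -- only its values at pairs (I , a) with IsIdeal I and InA I a matter.
  EdgeField : Set c
  EdgeField = Subset n → Fin n → A

  -- A diamond field: only values at diamonds (K; a, b) matter.
  DiamondField : Set c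
  DiamondField = Subset n → Fin n → Fin n → A

  IsDiamond : Subset n → Fin n → Fin n → Set (p ⊔ t)
  IsDiamond K a b = IsIdeal K × InA K a × InA K b × Incomparable a b × (a <τ b)

  curvature : EdgeField → DiamondField
  curvature g K a b = ((g K b ∙ g (K ∪ ⁅ b ⁆) a) ⊖ g K a) ⊖ g (K ∪ ⁅ a ⁆) b

  CubeConsistent : DiamondField → Set (p ⊔ t ⊔ ℓ)
  CubeConsistent κ =
    ∀ I u v w → IsIdeal I → InA I u → InA I v → InA I w →
    Incomparable u v → Incomparable u w → Incomparable v w →
    u <τ v → v <τ w →
    ((((( κ I u v ⊖ κ (I ∪ ⁅ w ⁆) u v) ⊖ κ I u w)
         ∙ κ (I ∪ ⁅ v ⁆) u w) ∙ κ I v w) ⊖ κ (I ∪ ⁅ u ⁆) v w) ≈ ε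

  -- x = m(K), the <τ-maximum of K (this forces K nonempty)
  IsTauMax : Subset n → Fin n → Set t
  IsTauMax K x = (x ∈ K) × (∀ y → y ∈ K → y ≢ x → y <τ x)

  Normalized : EdgeField → Set (p ⊔ t ⊔ ℓ)
  Normalized g = ∀ K x → IsIdeal K → IsTauMax K x → g (K ─ ⁅ x ⁆) x ≈ ε

  HasCurvature : EdgeField → DiamondField → Set (p ⊔ t ⊔ ℓ)
  HasCurvature g κ = ∀ K a b → IsDiamond K a b → curvature g K a b ≈ κ K a b

  SameEdgeField : EdgeField → EdgeField → Set (p ⊔ ℓ)
  SameEdgeField g h = ∀ I a → IsIdeal I → InA I a → g I a ≈ h I a

{-# OPTIONS --safe #-}

-- Removing the τ-maximum x of a nonempty ideal I leaves an ideal, and for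
-- a <τ x the diamond (I − x; a, x) together with normalisation forces
-- g(I, a) = κ(I − x; a, x) + g(I − x, a), while g(I, a) = 0 when a lies
-- τ-above all of I.  So the normalised edge fields with curvature κ are
-- exactly the solutions of this recurrence, and the recurrence has exactly
-- one solution.  That this solution has curvature κ is proved by peeling the
-- top x off a diamond (K; a, b) with b <τ x: the curvature changes by the
-- curvature of the edge field κ(−; −, x), which cube consistency identifies
-- with the increment κ(K; a, b) − κ(K − x; a, b).

module Submission where

open import Defs
open import Level using (Level; _⊔_)
open import Data.Nat using (ℕ)
open import Data.Fin using (Fin; _≟_)
open import Data.Vec.Base using (_∷_; there)
open import Data.Fin.Subset using (Subset; _∈_; _∉_; _∪_; _─_; _-_; ⁅_⁆; _⊂_; Nonempty)
open import Data.Fin.Subset.Properties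
  using (_∈?_; x∈p∪q⁻; x∈p∪q⁺; p⊆p∪q; x∈⁅x⁆; x∈⁅y⁆⇒x≡y; x∉⁅y⁆⇒x≢y; p─q⊆p;
         x∈p∧x≢y⇒x∈p-y; x∈p⇒p-x⊂p; ⊆-antisym; ∪-assoc; ∪-comm; nonempty?)
open import Data.Fin.Subset.Induction using (Acc; acc; ⊂-wellFounded)
open import Data.List.Base using (List; filter; allFin)
open import Data.List.Relation.Unary.All using (lookup)
open import Data.List.Membership.Propositional.Properties using (∈-filter⁺; ∈-filter⁻; ∈-allFin)
import Data.List.Extrema
open import Data.Product using (_×_; Σ; _,_; proj₁; proj₂; ∃)
open import Data.Sum using (_⊎_; inj₁; inj₂; [_,_]′)
import Data.Sum as Sum
open import Function.Base using (id; _∘_; _$_)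
open import Induction.WellFounded using (module All; module FixPoint)
open import Relation.Binary.Core using (Rel)
open import Relation.Binary.Bundles using (TotalOrder)
open import Relation.Binary.Structures using (IsPartialOrder; IsStrictTotalOrder)
open import Relation.Binary.Definitions using (tri<; tri≈; tri>)
import Relation.Binary.Construct.StrictToNonStrict as StrictToNonStrict
open import Relation.Binary.PropositionalEquality
  using (_≡_; _≢_; refl; sym; trans; cong; subst; module ≡-Reasoning)
open import Relation.Nullary using (yes; no; contradiction)
open import Algebra.Bundles using (AbelianGroup)

private
  variable
    n : ℕ
    p : Subset n
    x y : Fin n

x∈p∪⁅y⁆⁻ : x ∈ p ∪ ⁅ y ⁆ → x ∈ p ⊎ x ≡ y
x∈p∪⁅y⁆⁻ {p = p} {y = y} = Sum.map₂ (x∈⁅y⁆⇒x≡y y) ∘ x∈p∪q⁻ p ⁅ y ⁆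

x∈p∪⁅x⁆ : x ∈ p ∪ ⁅ x ⁆
x∈p∪⁅x⁆ {x = x} = x∈p∪q⁺ (inj₂ (x∈⁅x⁆ x))

x∈p─q⇒x∉q : ∀ (p q : Subset n) → x ∈ p ─ q → x ∉ q
x∈p─q⇒x∉q (_ ∷ p) (_ ∷ q) (there x∈p─q) (there x∈q) = x∈p─q⇒x∉q p q x∈p─q x∈q

x∈p-y⁻ : x ∈ p - y → x ∈ p × x ≢ y
x∈p-y⁻ {p = p} {y = y} x∈ = p─q⊆p p ⁅ y ⁆ x∈ , x∉⁅y⁆⇒x≢y (x∈p─q⇒x∉q p ⁅ y ⁆ x∈)

p∪⁅x⁆-x≡p : x ∉ p → (p ∪ ⁅ x ⁆) - x ≡ p
p∪⁅x⁆-x≡p {x = x} {p = p} x∉p = ⊆-antisym ⊆ ⊇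
  where
  ⊆ : ∀ {y} → y ∈ (p ∪ ⁅ x ⁆) - x → y ∈ p
  ⊆ y∈ = let (y∈p∪x , y≢x) = x∈p-y⁻ y∈ in [ id , (λ y≡x → contradiction y≡x y≢x) ]′ (x∈p∪⁅y⁆⁻ y∈p∪x)
  ⊇ : ∀ {y} → y ∈ p → y ∈ (p ∪ ⁅ x ⁆) - x
  ⊇ y∈p = x∈p∧x≢y⇒x∈p-y (p⊆p∪q _ y∈p) (λ { refl → x∉p y∈p })

p-x∪⁅x⁆≡p : x ∈ p → (p - x) ∪ ⁅ x ⁆ ≡ p
p-x∪⁅x⁆≡p {x = x} {p = p} x∈p = ⊆-antisym ⊆ ⊇
  where
  ⊆ : ∀ {y} → y ∈ (p - x) ∪ ⁅ x ⁆ → y ∈ p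
  ⊆ y∈ = [ proj₁ ∘ x∈p-y⁻ , (λ { refl → x∈p }) ]′ (x∈p∪⁅y⁆⁻ y∈)
  ⊇ : ∀ {y} → y ∈ p → y ∈ (p - x) ∪ ⁅ x ⁆
  ⊇ {y} y∈p with y ≟ x
  ... | yes refl = x∈p∪⁅x⁆
  ... | no y≢x = p⊆p∪q _ (x∈p∧x≢y⇒x∈p-y y∈p y≢x)

p∪⁅x⁆∪⁅y⁆≡p∪⁅y⁆∪⁅x⁆ : (p ∪ ⁅ x ⁆) ∪ ⁅ y ⁆ ≡ (p ∪ ⁅ y ⁆) ∪ ⁅ x ⁆
p∪⁅x⁆∪⁅y⁆≡p∪⁅y⁆∪⁅x⁆ {p = p} {x = x} {y = y} = begin
  (p ∪ ⁅ x ⁆) ∪ ⁅ y ⁆  ≡⟨ ∪-assoc p ⁅ x ⁆ ⁅ y ⁆ ⟩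
  p ∪ (⁅ x ⁆ ∪ ⁅ y ⁆)  ≡⟨ cong (p ∪_) (∪-comm ⁅ x ⁆ ⁅ y ⁆) ⟩
  p ∪ (⁅ y ⁆ ∪ ⁅ x ⁆)  ≡⟨ sym (∪-assoc p ⁅ y ⁆ ⁅ x ⁆) ⟩
  (p ∪ ⁅ y ⁆) ∪ ⁅ x ⁆  ∎
  where open ≡-Reasoning

p⊂p∪⁅x⁆ : x ∉ p → p ⊂ p ∪ ⁅ x ⁆
p⊂p∪⁅x⁆ {x = x} x∉p = p⊆p∪q ⁅ x ⁆ , x , x∈p∪⁅x⁆ , x∉p

module Greatest {t} {_<_ : Rel (Fin n) t} (sto : IsStrictTotalOrder _≡_ _<_) where

  open IsStrictTotalOrder sto using (asym)

  private
    nonStrictTotalOrder : TotalOrder _ _ _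
    nonStrictTotalOrder = record { isTotalOrder = StrictToNonStrict.isTotalOrder _≡_ _<_ sto }

  open Data.List.Extrema nonStrictTotalOrder using (max; xs≤max; argmax-sel)

  IsGreatest : Subset n → Fin n → Set t
  IsGreatest I x = x ∈ I × (∀ y → y ∈ I → y ≢ x → y < x)

  -- Opaque, so that proofs can abstract over `greatest I ne` with `with`.
  opaque
    greatest : (I : Subset n) → Nonempty I → ∃ (IsGreatest I)
    greatest I (x₀ , x₀∈I) = m , m∈I , y<m
      where
      elements : List (Fin n)
      elements = filter (_∈? I) (allFin n)
      m : Fin n
      m = max x₀ elements
      m∈I : m ∈ I
      m∈I = [ (λ m≡x₀ → subst (_∈ I) (sym m≡x₀) x₀∈I) , proj₂ ∘ ∈-filter⁻ (_∈? I) {xs = allFin n} ]′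
              (argmax-sel id x₀ elements)
      y<m : ∀ y → y ∈ I → y ≢ m → y < m
      y<m y y∈I y≢m = [ id , (λ y≡m → contradiction y≡m y≢m) ]′
                        (lookup (xs≤max x₀ elements) (∈-filter⁺ (_∈? I) (∈-allFin y) y∈I))

  greatest-unique : ∀ {I x y} → IsGreatest I x → IsGreatest I y → x ≡ y
  greatest-unique {x = x} {y} (x∈I , below-x) (y∈I , below-y) with x ≟ y
  ... | yes x≡y = x≡y
  ... | no x≢y = contradiction (below-y x x∈I x≢y) (asym (below-x y y∈I (x≢y ∘ sym)))

module SquareSum {c ℓ} (G : AbelianGroup c ℓ) where

  open AbelianGroup G
    using (Carrier; _≈_; _∙_; ε; _⁻¹; ∙-cong; ∙-congˡ; ∙-congʳ; ⁻¹-cong;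
           identityˡ; identityʳ; setoid; group; commutativeMonoid)
    renaming (_-_ to _⊖_; refl to ≈-refl; sym to ≈-sym; trans to ≈-trans)
  open import Algebra.Properties.AbelianGroup G using (⁻¹-∙-comm)
  open import Algebra.Properties.Group group
    using (ε⁻¹≈ε; //-rightDividesˡ; //-rightDividesʳ)
  open import Algebra.Solver.CommutativeMonoid commutativeMonoid using (solve; _⊜_; _⊕_)
  open import Relation.Binary.Reasoning.Setoid setoid

  squareSum : Carrier → Carrier → Carrier → Carrier → Carrier
  squareSum w x y z = ((w ∙ x) ⊖ y) ⊖ z

  squareSum-cong : ∀ {w w′ x x′ y y′ z z′} → w ≈ w′ → x ≈ x′ → y ≈ y′ → z ≈ z′ →
                   squareSum w x y z ≈ squareSum w′ x′ y′ z′
  squareSum-cong w≈ x≈ y≈ z≈ = ∙-cong (∙-cong (∙-cong w≈ x≈) (⁻¹-cong y≈)) (⁻¹-cong z≈)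

  squareSum-∙ : ∀ w x y z w′ x′ y′ z′ →
                squareSum (w ∙ w′) (x ∙ x′) (y ∙ y′) (z ∙ z′) ≈ squareSum w x y z ∙ squareSum w′ x′ y′ z′
  squareSum-∙ w x y z w′ x′ y′ z′ = begin
    ((w ∙ w′) ∙ (x ∙ x′)) ∙ (y ∙ y′) ⁻¹ ∙ (z ∙ z′) ⁻¹
      ≈⟨ ∙-cong (∙-congˡ (≈-sym (⁻¹-∙-comm y y′))) (≈-sym (⁻¹-∙-comm z z′)) ⟩
    ((w ∙ w′) ∙ (x ∙ x′)) ∙ (y ⁻¹ ∙ y′ ⁻¹) ∙ (z ⁻¹ ∙ z′ ⁻¹)
      ≈⟨ solve 8 (λ w w′ x x′ y y′ z z′ →
                    (((w ⊕ w′) ⊕ (x ⊕ x′)) ⊕ (y ⊕ y′)) ⊕ (z ⊕ z′)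
                  ⊜ (((w ⊕ x) ⊕ y) ⊕ z) ⊕ (((w′ ⊕ x′) ⊕ y′) ⊕ z′))
               ≈-refl w w′ x x′ (y ⁻¹) (y′ ⁻¹) (z ⁻¹) (z′ ⁻¹) ⟩
    squareSum w x y z ∙ squareSum w′ x′ y′ z′ ∎

  squareSum-ε-ε : ∀ x y → squareSum ε x y ε ≈ x ⊖ y
  squareSum-ε-ε x y = begin
    ((ε ∙ x) ⊖ y) ∙ ε ⁻¹  ≈⟨ ∙-cong (∙-congʳ (identityˡ x)) ε⁻¹≈ε ⟩
    (x ⊖ y) ∙ ε           ≈⟨ identityʳ (x ⊖ y) ⟩
    x ⊖ y                 ∎

  x⊖y≈z⇒x≈z∙y : ∀ {x y z} → x ⊖ y ≈ z → x ≈ z ∙ y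
  x⊖y≈z⇒x≈z∙y {x} {y} x⊖y≈z = ≈-trans (≈-sym (//-rightDividesˡ y x)) (∙-congʳ x⊖y≈z)

  x≈z∙y⇒x⊖y≈z : ∀ {x y z} → x ≈ z ∙ y → x ⊖ y ≈ z
  x≈z∙y⇒x⊖y≈z {y = y} {z} x≈z∙y = ≈-trans (∙-congʳ x≈z∙y) (//-rightDividesʳ y z)

  squareSum-∙-⊖ : ∀ u v α β γ δ →
                  (squareSum γ β α δ ∙ u) ⊖ v ≈ ((((u ⊖ v) ⊖ α) ∙ β) ∙ γ) ⊖ δ
  squareSum-∙-⊖ u v α β γ δ =
    solve 6 (λ u v α β γ δ → ((((γ ⊕ β) ⊕ α) ⊕ δ) ⊕ u) ⊕ v ⊜ ((((u ⊕ v) ⊕ α) ⊕ β) ⊕ γ) ⊕ δ)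
            ≈-refl u (v ⁻¹) (α ⁻¹) β γ (δ ⁻¹)

module Construction
  {p t c ℓ} (_≼_ : Fin n → Fin n → Set p)
  (_<τ_ : Fin n → Fin n → Set t) (τ-strictTotal : IsStrictTotalOrder _≡_ _<τ_)
  (τ-extends-≼ : ∀ u v → u ≼ v → u ≢ v → u <τ v)
  (G : AbelianGroup c ℓ) where

  open Setup _≼_ _<τ_ G
  open IsStrictTotalOrder τ-strictTotal
    using (compare; irrefl; asym) renaming (trans to <τ-trans; _<?_ to _<τ?_)
  open Greatest τ-strictTotal
  open AbelianGroup G using (_≈_; _∙_; ε; ∙-congˡ; setoid; group)
    renaming (Carrier to A; refl to ≈-refl; sym to ≈-sym; trans to ≈-trans;
              reflexive to ≈-reflexive)
  open import Algebra.Properties.Group group using (x∙y⁻¹≈ε⇒x≈y)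
  open SquareSum G
  open import Relation.Binary.Reasoning.Setoid setoid

  private
    variable
      I K : Subset n
      a b u v : Fin n

  ≺⇒<τ : u ≺ v → u <τ v
  ≺⇒<τ (u≼v , u≢v) = τ-extends-≼ _ _ u≼v u≢v

  Above : Subset n → Fin n → Set t
  Above I a = ∀ y → y ∈ I → y <τ a

  above⇒∉ : Above I a → a ∉ I
  above⇒∉ above a∈I = irrefl refl (above _ a∈I)

  above-∪ : Above I x → a <τ x → Above (I ∪ ⁅ a ⁆) x
  above-∪ above a<x y y∈ = [ above y , (λ { refl → a<x }) ]′ (x∈p∪⁅y⁆⁻ y∈)

  above⇒greatest : Above I x → IsTauMax (I ∪ ⁅ x ⁆) x
  above⇒greatest above =
    x∈p∪⁅x⁆ , λ y y∈ y≢x → [ above y , (λ y≡x → contradiction y≡x y≢x) ]′ (x∈p∪⁅y⁆⁻ y∈)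

  greatest⇒above : IsTauMax I x → Above (I - x) x
  greatest⇒above (_ , below) y y∈ = let (y∈I , y≢x) = x∈p-y⁻ y∈ in below y y∈I y≢x

  greatest-<τ⇒above : IsTauMax I x → x <τ a → Above I a
  greatest-<τ⇒above {x = x} (_ , below) x<a y y∈I with y ≟ x
  ... | yes refl = x<a
  ... | no y≢x = <τ-trans (below y y∈I y≢x) x<a

  ideal-∪ : IsIdeal I → InA I a → IsIdeal (I ∪ ⁅ a ⁆)
  ideal-∪ ideal (_ , preds) c b b≼c c∈ with x∈p∪⁅y⁆⁻ c∈ | b ≟ c
  ... | inj₁ c∈I  | _        = p⊆p∪q _ (ideal c b b≼c c∈I)
  ... | inj₂ refl | yes refl = x∈p∪⁅x⁆
  ... | inj₂ refl | no b≢c   = p⊆p∪q _ (preds b (b≼c , b≢c))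

  ideal-remove-greatest : IsIdeal I → IsTauMax I x → IsIdeal (I - x)
  ideal-remove-greatest ideal (_ , below) c b b≼c c∈ =
    let (c∈I , c≢x) = x∈p-y⁻ c∈ in
    x∈p∧x≢y⇒x∈p-y (ideal c b b≼c c∈I)
      (λ { refl → asym (below c c∈I c≢x) (≺⇒<τ (b≼c , c≢x ∘ sym)) })

  inA-remove-greatest : IsIdeal I → IsTauMax I x → InA (I - x) x
  inA-remove-greatest ideal (x∈I , _) =
    (λ x∈ → proj₂ (x∈p-y⁻ x∈) refl) ,
    λ u (u≼x , u≢x) → x∈p∧x≢y⇒x∈p-y (ideal _ u u≼x x∈I) u≢x

  inA-∪ : InA I a → a ≢ b → InA (I ∪ ⁅ b ⁆) a
  inA-∪ (a∉I , preds) a≢b =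
    (λ a∈ → [ a∉I , a≢b ]′ (x∈p∪⁅y⁆⁻ a∈)) , λ u u≺a → p⊆p∪q _ (preds u u≺a)

  inA-∪⁻ : InA (I ∪ ⁅ x ⁆) a → a <τ x → InA I a
  inA-∪⁻ (a∉ , preds) a<x =
    (a∉ ∘ p⊆p∪q _) ,
    λ u u≺a → [ id , (λ { refl → contradiction (≺⇒<τ u≺a) (asym a<x) }) ]′ (x∈p∪⁅y⁆⁻ (preds u u≺a))

  <τ⇒≢ : a <τ b → a ≢ b
  <τ⇒≢ a<b a≡b = irrefl a≡b a<b

  addable-incomparable : InA I a → InA I b → a <τ b → Incomparable a b
  addable-incomparable (a∉I , _) (_ , preds) a<b =
    (λ a≼b → a∉I (preds _ (a≼b , <τ⇒≢ a<b))) ,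
    (λ b≼a → asym a<b (≺⇒<τ (b≼a , <τ⇒≢ a<b ∘ sym)))

  curvature-b-edges-ε : ∀ g → g K b ≈ ε → g (K ∪ ⁅ a ⁆) b ≈ ε →
                        curvature g K a b ≈ g (K ∪ ⁅ b ⁆) a ⊖ g K a
  curvature-b-edges-ε _ gKb≈ε gKab≈ε =
    ≈-trans (squareSum-cong gKb≈ε ≈-refl ≈-refl gKab≈ε) (squareSum-ε-ε _ _)

  data Position (a : Fin n) : Subset n → Set (p ⊔ t) where
    above : Above I a → Position a I
    below : IsIdeal K → InA K x → Above K x → a <τ x → Position a (K ∪ ⁅ x ⁆)

  position : IsIdeal I → a ∉ I → Position a I
  position {I} {a} ideal a∉I with nonempty? I
  ... | no empty = above (λ y y∈I → contradiction (y , y∈I) empty)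
  ... | yes nonempty with greatest I nonempty
  ...   | x , greatest-x with compare x a
  ...     | tri< x<a _ _ = above (greatest-<τ⇒above greatest-x x<a)
  ...     | tri≈ _ refl _ = contradiction (proj₁ greatest-x) a∉I
  ...     | tri> _ _ a<x = subst (Position a) (p-x∪⁅x⁆≡p (proj₁ greatest-x))
                             (below (ideal-remove-greatest ideal greatest-x)
                                    (inA-remove-greatest ideal greatest-x)
                                    (greatest⇒above greatest-x) a<x)

  module _ (κ : DiamondField) where

    record Recurrence (g : EdgeField) : Set (p ⊔ t ⊔ ℓ) where
      field
        base : IsIdeal I → InA I a → Above I a → g I a ≈ ε
        step : IsIdeal K → InA K x → Above K x → InA K a → a <τ x →
               g (K ∪ ⁅ x ⁆) a ≈ κ K a x ∙ g K a

    private
      peel : Fin n → (I : Subset n) → (∀ {J} → J ⊂ I → A) → A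
      peel a I rec with nonempty? I
      ... | no _ = ε
      ... | yes nonempty with greatest I nonempty
      ...   | x , greatest-x with x <τ? a
      ...     | yes _ = ε
      ...     | no _ = κ (I - x) a x ∙ rec (x∈p⇒p-x⊂p (proj₁ greatest-x))

      peel-ext : ∀ a I {rec rec′ : ∀ {J} → J ⊂ I → A} →
                 (∀ {J} (J⊂I : J ⊂ I) → rec J⊂I ≡ rec′ J⊂I) → peel a I rec ≡ peel a I rec′
      peel-ext a I rec≡rec′ with nonempty? I
      ... | no _ = refl
      ... | yes nonempty with greatest I nonempty
      ...   | x , _ with x <τ? a
      ...     | yes _ = refl
      ...     | no _ = cong (κ (I - x) a x ∙_) (rec≡rec′ _)

      peel-above : (f : Subset n → A) → Above I a → peel a I (λ {J} _ → f J) ≡ ε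
      peel-above {I} {a} f above-a with nonempty? I
      ... | no _ = refl
      ... | yes nonempty with greatest I nonempty
      ...   | x , x∈I , _ with x <τ? a
      ...     | yes _ = refl
      ...     | no x≮a = contradiction (above-a x x∈I) x≮a

      peel-greatest : (f : Subset n → A) → IsTauMax I x → a <τ x →
                      peel a I (λ {J} _ → f J) ≡ κ (I - x) a x ∙ f (I - x)
      peel-greatest {I} {x} {a} f greatest-x a<x with nonempty? I
      ... | no empty = contradiction (x , proj₁ greatest-x) empty
      ... | yes nonempty with greatest I nonempty
      ...   | y , greatest-y with greatest-unique greatest-y greatest-x
      ...     | refl with y <τ? a
      ...       | yes y<a = contradiction y<a (asym a<x)
      ...       | no _ = refl

    -- Opaque: canonical is only used through canonical-unfold, and letting the type
    -- checker unfold the well-founded recursion makes checking prohibitively slow.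
    opaque
      canonical : EdgeField
      canonical I a = All.wfRec ⊂-wellFounded c (λ _ → A) (peel a) I

      canonical-unfold : ∀ I a → canonical I a ≡ peel a I (λ {J} _ → canonical J a)
      canonical-unfold I a =
        FixPoint.unfold-wfRec ⊂-wellFounded (λ _ → A) (peel a) (λ I → peel-ext a I)

    canonical-above : Above I a → canonical I a ≈ ε
    canonical-above {I} {a} above-a = ≈-reflexive $
      trans (canonical-unfold I a) (peel-above (λ J → canonical J a) above-a)

    canonical-∪-top : Above K x → a <τ x → canonical (K ∪ ⁅ x ⁆) a ≈ κ K a x ∙ canonical K a
    canonical-∪-top {K} {x} {a} above-x a<x = begin
      canonical (K ∪ ⁅ x ⁆) a
        ≡⟨ canonical-unfold _ a ⟩
      peel a (K ∪ ⁅ x ⁆) (λ {J} _ → canonical J a)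
        ≡⟨ peel-greatest (λ J → canonical J a) (above⇒greatest above-x) a<x ⟩
      κ ((K ∪ ⁅ x ⁆) - x) a x ∙ canonical ((K ∪ ⁅ x ⁆) - x) a
        ≡⟨ cong (λ J → κ J a x ∙ canonical J a) (p∪⁅x⁆-x≡p (above⇒∉ above-x)) ⟩
      κ K a x ∙ canonical K a ∎

    canonical-recurrence : Recurrence canonical
    canonical-recurrence = record
      { base = λ _ _ → canonical-above
      ; step = λ _ _ above-x _ → canonical-∪-top above-x
      }

    slice : Fin n → EdgeField
    slice x J c = κ J c x

    curvature-slice : CubeConsistent κ → IsIdeal I → InA I a → InA I b → InA I x →
                      Incomparable a b → a <τ b → b <τ x →
                      curvature (slice x) I a b ∙ κ I a b ≈ κ (I ∪ ⁅ x ⁆) a b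
    curvature-slice {I} {a} {b} {x} cube ideal a-addable b-addable x-addable a∥b a<b b<x =
      x∙y⁻¹≈ε⇒x≈y _ _ (≈-trans (squareSum-∙-⊖ _ _ _ _ _ _)
        (cube I a b x ideal a-addable b-addable x-addable a∥b
              (addable-incomparable a-addable x-addable (<τ-trans a<b b<x))
              (addable-incomparable b-addable x-addable b<x) a<b b<x))

    module _ {g : EdgeField} (recurrence : Recurrence g) where

      open Recurrence recurrence

      recurrence⇒normalized : Normalized g
      recurrence⇒normalized K x ideal greatest-x =
        base (ideal-remove-greatest ideal greatest-x) (inA-remove-greatest ideal greatest-x)
             (greatest⇒above greatest-x)

      recurrence-unique : ∀ {h} → Recurrence h → SameEdgeField g h
      recurrence-unique {h} recurrence-h I a = unique-on (⊂-wellFounded I)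
        where
        module H = Recurrence recurrence-h
        unique-on : ∀ {I} → Acc _⊂_ I → IsIdeal I → InA I a → g I a ≈ h I a
        unique-on (acc rec) ideal a-addable with position ideal (proj₁ a-addable)
        ... | above above-a =
          ≈-trans (base ideal a-addable above-a) (≈-sym (H.base ideal a-addable above-a))
        ... | below {K} {x} ideal-K x-addable above-x a<x = begin
          g (K ∪ ⁅ x ⁆) a  ≈⟨ step ideal-K x-addable above-x a-addable-K a<x ⟩
          κ K a x ∙ g K a  ≈⟨ ∙-congˡ (unique-on (rec (p⊂p∪⁅x⁆ (above⇒∉ above-x))) ideal-K a-addable-K) ⟩
          κ K a x ∙ h K a  ≈⟨ H.step ideal-K x-addable above-x a-addable-K a<x ⟨
          h (K ∪ ⁅ x ⁆) a  ∎
          where a-addable-K = inA-∪⁻ a-addable a<x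

      curvature-∪-top : IsIdeal K → InA K x → Above K x → InA K a → InA K b → a <τ b → b <τ x →
                        curvature g (K ∪ ⁅ x ⁆) a b
                          ≈ curvature (slice x) K a b ∙ curvature g K a b
      curvature-∪-top {K} {x} {a} {b} ideal x-addable above-x a-addable b-addable a<b b<x = begin
        curvature g (K ∪ ⁅ x ⁆) a b
          ≈⟨ squareSum-cong (step ideal x-addable above-x b-addable b<x)
                            (step-∪ b-addable a-addable b<x a<x (<τ⇒≢ a<b))
                            (step ideal x-addable above-x a-addable a<x)
                            (step-∪ a-addable b-addable a<x b<x (<τ⇒≢ a<b ∘ sym)) ⟩
        squareSum (κ K b x ∙ g K b) (κ (K ∪ ⁅ b ⁆) a x ∙ g (K ∪ ⁅ b ⁆) a)
                  (κ K a x ∙ g K a) (κ (K ∪ ⁅ a ⁆) b x ∙ g (K ∪ ⁅ a ⁆) b)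
          ≈⟨ squareSum-∙ _ _ _ _ _ _ _ _ ⟩
        curvature (slice x) K a b ∙ curvature g K a b ∎
        where
        a<x = <τ-trans a<b b<x
        step-∪ : InA K u → InA K v → u <τ x → v <τ x → v ≢ u →
                 g ((K ∪ ⁅ x ⁆) ∪ ⁅ u ⁆) v ≈ κ (K ∪ ⁅ u ⁆) v x ∙ g (K ∪ ⁅ u ⁆) v
        step-∪ {u} {v} u-addable v-addable u<x v<x v≢u = begin
          g ((K ∪ ⁅ x ⁆) ∪ ⁅ u ⁆) v  ≡⟨ cong (λ J → g J v) p∪⁅x⁆∪⁅y⁆≡p∪⁅y⁆∪⁅x⁆ ⟩
          g ((K ∪ ⁅ u ⁆) ∪ ⁅ x ⁆) v  ≈⟨ step (ideal-∪ ideal u-addable) (inA-∪ x-addable (<τ⇒≢ u<x ∘ sym))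
                                             (above-∪ above-x u<x) (inA-∪ v-addable v≢u) v<x ⟩
          κ (K ∪ ⁅ u ⁆) v x ∙ g (K ∪ ⁅ u ⁆) v ∎

      recurrence⇒curvature : CubeConsistent κ → HasCurvature g κ
      recurrence⇒curvature cube K a b = curvature-on (⊂-wellFounded K)
        where
        curvature-on : ∀ {K} → Acc _⊂_ K → IsDiamond K a b → curvature g K a b ≈ κ K a b
        curvature-on {K} (acc rec) (ideal , a-addable , b-addable , a∥b , a<b)
          with position ideal (proj₁ b-addable)
        ... | above above-b = begin
          curvature g K a b
            ≈⟨ curvature-b-edges-ε g (base ideal b-addable above-b)
                 (base (ideal-∪ ideal a-addable) (inA-∪ b-addable (<τ⇒≢ a<b ∘ sym)) (above-∪ above-b a<b)) ⟩
          g (K ∪ ⁅ b ⁆) a ⊖ g K a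
            ≈⟨ x≈z∙y⇒x⊖y≈z (step ideal b-addable above-b a-addable a<b) ⟩
          κ K a b ∎
        ... | below {K′} {x} ideal-K′ x-addable above-x b<x = begin
          curvature g (K′ ∪ ⁅ x ⁆) a b
            ≈⟨ curvature-∪-top ideal-K′ x-addable above-x a-addable-K′ b-addable-K′ a<b b<x ⟩
          curvature (slice x) K′ a b ∙ curvature g K′ a b
            ≈⟨ ∙-congˡ (curvature-on (rec (p⊂p∪⁅x⁆ (above⇒∉ above-x)))
                                     (ideal-K′ , a-addable-K′ , b-addable-K′ , a∥b , a<b)) ⟩
          curvature (slice x) K′ a b ∙ κ K′ a b
            ≈⟨ curvature-slice cube ideal-K′ a-addable-K′ b-addable-K′ x-addable a∥b a<b b<x ⟩
          κ (K′ ∪ ⁅ x ⁆) a b ∎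
          where
          a-addable-K′ = inA-∪⁻ a-addable (<τ-trans a<b b<x)
          b-addable-K′ = inA-∪⁻ b-addable b<x

    normalized-curvature⇒recurrence : ∀ {g} → Normalized g → HasCurvature g κ → Recurrence g
    normalized-curvature⇒recurrence {g} normalized curvature-κ = record { base = base ; step = step }
      where
      base : IsIdeal I → InA I a → Above I a → g I a ≈ ε
      base {I} {a} ideal a-addable above-a = begin
        g I a                    ≡⟨ cong (λ J → g J a) (p∪⁅x⁆-x≡p (above⇒∉ above-a)) ⟨
        g ((I ∪ ⁅ a ⁆) - a) a    ≈⟨ normalized _ a (ideal-∪ ideal a-addable) (above⇒greatest above-a) ⟩
        ε                        ∎
      step : IsIdeal K → InA K x → Above K x → InA K a → a <τ x →
             g (K ∪ ⁅ x ⁆) a ≈ κ K a x ∙ g K a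
      step {K} {x} {a} ideal x-addable above-x a-addable a<x = x⊖y≈z⇒x≈z∙y (begin
        g (K ∪ ⁅ x ⁆) a ⊖ g K a
          ≈⟨ curvature-b-edges-ε g (base ideal x-addable above-x)
               (base (ideal-∪ ideal a-addable) (inA-∪ x-addable (<τ⇒≢ a<x ∘ sym)) (above-∪ above-x a<x)) ⟨
        curvature g K a x
          ≈⟨ curvature-κ K a x diamond ⟩
        κ K a x ∎)
        where
        diamond : IsDiamond K a x
        diamond = ideal , a-addable , x-addable , addable-incomparable a-addable x-addable a<x , a<x

theorem9 : {p t c ℓ : Level} (n : ℕ)
    (_≼_ : Fin n → Fin n → Set p) → IsPartialOrder _≡_ _≼_ →
    (_<τ_ : Fin n → Fin n → Set t) → IsStrictTotalOrder _≡_ _<τ_ →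
    (∀ u v → u ≼ v → u ≢ v → u <τ v) →
    (G : AbelianGroup c ℓ) →
    let open Setup _≼_ _<τ_ G in
    (κ : DiamondField) → CubeConsistent κ →
    Σ EdgeField (λ g0 → (Normalized g0 × HasCurvature g0 κ)
      × (∀ h → Normalized h → HasCurvature h κ → SameEdgeField h g0))
theorem9 n _≼_ _ _<τ_ τ-strictTotal τ-extends-≼ G κ cube =
  canonical κ ,
  (recurrence⇒normalized κ solution , recurrence⇒curvature κ solution cube) ,
  λ h normalized curvature-κ →
    recurrence-unique κ (normalized-curvature⇒recurrence κ normalized curvature-κ) solution
  where
  open Construction _≼_ _<τ_ τ-strictTotal τ-extends-≼ G
  solution : Recurrence κ (canonical κ)
  solution = canonical-recurrence κ
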